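{- Let $a,b$ be positive integers and let $h_j=h^{a,b}_j$ denote the number of tilings of the honeycomb strip $H_j$ by monomers of $a$ colors and dimers of $b$ colors, with $h_0=1$ and $h_j=0$ for $j<0$. Then for all integers $m,n\ge 0$, $$h_{m+n}=h_mh_n+h_{m-1}\bigl(b\,h_{n-1}+ab\,h_{n-2}+b^2h_{n-3}\bigr)+h_{m-2}\bigl(ab\,h_{n-1}+b^2h_{n-2}\bigr)+b^2h_{n-1}h_{m-3}.$$
   Context: The honeycomb strip $H_n$ consists of $n$ regular hexagons arranged in two rows, numbered $1,\dots,n$ from the bottom left so that odd-numbered hexagons form the bottom row and even-numbered ones the top row; hexagon $i$ shares an edge with hexagons $i\pm1$ and $i\pm2$ (when they exist), and with no others. A monomer is a single hexagon; a dimer is a pair of edge-adjacent hexagons, i.e. either $\{i,i+1\}$ (slanted) or $\{i,i+2\}$ (horizontal). A tiling of $H_n$ is a partition of its hexagons into monomers and dimers; in a colored tiling each monomer receives one of $a$ colors and each dimer one of $b$ colors. -}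

module Defs where

open import Data.Nat using (ℕ; zero; suc; _+_; _*_; _^_; _<?_; ∣_-_∣)
import Data.Nat.Properties as ℕP
open import Data.Integer using (ℤ; +_; -[1+_])
open import Data.Fin using (Fin; toℕ)
open import Data.Fin.Properties using (all?) renaming (_≟_ to _≟ᶠ_)
open import Data.Vec using (Vec; []; _∷_; lookup)
open import Data.List using (List; []; _∷_; map; concatMap; filter; length; allFin)
open import Data.Nat.ListAction using (sum)
open import Data.Product using (_×_)
open import Data.Sum using (_⊎_)
open import Relation.Binary.PropositionalEquality using (_≡_)
open import Relation.Nullary using (Dec)
open import Relation.Nullary.Decidable using (_×-dec_; _⊎-dec_)

-- Hexagons of H_n are indexed by Fin n (hexagon k+1 of the paper is index k).
-- Hexagons i, j share an edge iff |i - j| ∈ {1, 2}.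
Adjacent : ∀ {n} → Fin n → Fin n → Set
Adjacent i j = ∣ toℕ i - toℕ j ∣ ≡ 1 ⊎ ∣ toℕ i - toℕ j ∣ ≡ 2

adjacent? : ∀ {n} (i j : Fin n) → Dec (Adjacent i j)
adjacent? i j = (∣ toℕ i - toℕ j ∣ ℕP.≟ 1) ⊎-dec (∣ toℕ i - toℕ j ∣ ℕP.≟ 2)

-- A tiling of H_n (partition into monomers and dimers) is encoded by its
-- partner map f : each hexagon i is sent to the other hexagon of its dimer,
-- or to itself if it is a monomer.
IsTiling : ∀ {n} → (Fin n → Fin n) → Set
IsTiling {n} f = ∀ (i : Fin n) → (f (f i) ≡ i) × (f i ≡ i ⊎ Adjacent i (f i))

isTiling? : ∀ {n} (f : Fin n → Fin n) → Dec (IsTiling f)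
isTiling? f = all? (λ i → (f (f i) ≟ᶠ i) ×-dec ((f i ≟ᶠ i) ⊎-dec adjacent? i (f i)))

monomers : ∀ {n} → (Fin n → Fin n) → ℕ
monomers {n} f = length (filter (λ i → f i ≟ᶠ i) (allFin n))

dimers : ∀ {n} → (Fin n → Fin n) → ℕ
dimers {n} f = length (filter (λ i → toℕ i <? toℕ (f i)) (allFin n))

allVecs : ∀ {A : Set} → List A → (k : ℕ) → List (Vec A k)
allVecs xs zero    = [] ∷ []
allVecs xs (suc k) = concatMap (λ x → map (x ∷_) (allVecs xs k)) xs

tilings : (n : ℕ) → List (Vec (Fin n) n)
tilings n = filter (λ v → isTiling? (lookup v)) (allVecs (allFin n) n)

-- h^{a,b}_n : number of colored tilings of H_n; a tiling with k monomers and
-- d dimers admits exactly a^k * b^d colorings.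
h : ℕ → ℕ → ℕ → ℕ
h a b n = sum (map (λ v → a ^ monomers (lookup v) * b ^ dimers (lookup v)) (tilings n))

hℤ : ℕ → ℕ → ℤ → ℕ
hℤ a b (+ n)    = h a b n
hℤ a b -[1+ _ ] = 0

-- Read from left to right, a tiling of H_n is a unique sequence of blocks of four
-- kinds: a monomer; a slanted dimer {i, i+1}; a horizontal dimer {i, i+2} enclosing
-- the monomer i+1; and two interleaved horizontal dimers {i, i+2}, {i+1, i+3}.  Their
-- colorings contribute the factors a, b, ab and b², so for n ≥ 1 (with h_j = 0 for j < 0)
--   h_n = a h_{n-1} + b h_{n-2} + ab h_{n-3} + b² h_{n-4},
-- i.e. x_k = h_{k-3} solves this four-term recurrence with x_0 = x_1 = x_2 = 0, x_3 = 1.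
-- For such a solution the right-hand side B(m, n) of the identity is bilinear in the
-- windows (x_{m+3}, …, x_m) and (x_{n+3}, …, x_n), the recurrence gives
-- B(m, n+1) = B(m+1, n), and B(0, n) = x_{n+3}; induction on m finishes the proof.
module Submission where

open import Defs
open import Data.Bool using (Bool; true; false; if_then_else_)
open import Data.Empty using (⊥-elim)
open import Data.Fin as Fin using (Fin; toℕ; fromℕ<)
import Data.Fin.Properties as Finₚ
open import Data.Integer using (_⊖_)
open import Data.Integer.Properties using (+-cancelˡ-⊖)
open import Data.List
  using (List; []; _∷_; _++_; map; concatMap; allFin; filter; length; tabulate; cartesianProductWith)
import Data.List.Properties as List
open import Data.List.Membership.Propositional using (_∈_)
open import Data.List.Membership.Propositional.Properties
  using (∈-map⁺; ∈-map⁻; ∈-filter⁺; ∈-filter⁻; ∈-++⁺ˡ; ∈-++⁺ʳ; ∈-++⁻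
        ; ∈-cartesianProductWith⁺; ∈-allFin)
open import Data.List.Membership.Propositional.Properties.WithK using (unique∧set⇒bag)
open import Data.List.Relation.Binary.BagAndSetEquality using (∼bag⇒↭)
open import Data.List.Relation.Binary.Permutation.Propositional using (_↭_)
import Data.List.Relation.Binary.Permutation.Propositional.Properties as ↭
import Data.List.Relation.Unary.All as All
open import Data.List.Relation.Unary.AllPairs using ([]; _∷_)
open import Data.List.Relation.Unary.Any using (here; there)
open import Data.List.Relation.Unary.Unique.Propositional using (Unique)
import Data.List.Relation.Unary.Unique.Propositional.Properties as Unique
import Data.Nat as ℕ
open import Data.Nat using (ℕ; zero; suc; z≤n; z<s; s<s; _+_; _*_; _^_; _∸_; _≤_; _<_; _<?_; ∣_-_∣)
open import Data.Nat.Induction using (<-rec)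
open import Data.Nat.ListAction using (sum)
open import Data.Nat.ListAction.Properties using (sum-↭; sum-++)
open import Data.Nat.Properties
  using ( +-assoc; +-suc; *-assoc; *-zeroʳ; *-distribˡ-+; +-cancelˡ-≡; +-cancelˡ-≤; +-monoʳ-≤
        ; ≤-refl; ≤-trans; <-trans; <-≤-trans; <-irrefl; <⇒≢; <⇒≱; ≰⇒>; ≮⇒≥; n<1+n; m≤m+n
        ; ∸-monoʳ-<; m≤n+m∸n; m+n∸m≡n; m+[n∸m]≡n; ∣m+n-m+o∣≡∣n-o∣ )
open import Data.Nat.Tactic.RingSolver using (solve-∀)
open import Data.Product using (_,_; _×_; ∃-syntax; proj₁; proj₂)
open import Data.Sum using (_⊎_; inj₁; inj₂)
open import Data.Vec as Vec using (Vec)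
import Data.Vec.Properties as Vecₚ
open import Function using (id; _∘_; case_of_)
open import Function.Bundles using (mk⇔)
open import Relation.Binary.PropositionalEquality
open import Relation.Nullary using (does; yes; no; ¬_)
open import Relation.Nullary.Decidable using (does-⇔)
open import Relation.Unary using (Decidable)

map⁺-local : ∀ {A B : Set} (f : A → B) {xs : List A} →
             (∀ {x y} → x ∈ xs → y ∈ xs → f x ≡ f y → x ≡ y) → Unique xs → Unique (map f xs)
map⁺-local f {[]}     inj []            = []
map⁺-local f {x ∷ xs} inj (x∉xs ∷ xs!) =
  All.tabulate fx∉ ∷ map⁺-local f (λ x∈ y∈ → inj (there x∈) (there y∈)) xs!
  where
  fx∉ : ∀ {z} → z ∈ map f xs → f x ≢ z
  fx∉ z∈ fx≡z with ∈-map⁻ f z∈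
  ... | y , y∈ , refl = All.lookup x∉xs y∈ (inj (here refl) (there y∈) fx≡z)

sum-map-*ˡ : ∀ k ns → sum (map (k *_) ns) ≡ k * sum ns
sum-map-*ˡ k []       = sym (*-zeroʳ k)
sum-map-*ˡ k (n ∷ ns) = trans (cong (k * n +_) (sum-map-*ˡ k ns)) (sym (*-distribˡ-+ k n (sum ns)))

concatMap-prepend : ∀ {A : Set} {k} (xs : List A) (vs : List (Vec A k)) →
                    concatMap (λ x → map (x Vec.∷_) vs) xs ≡ cartesianProductWith Vec._∷_ xs vs
concatMap-prepend []       vs = refl
concatMap-prepend (x ∷ xs) vs = cong (map (x Vec.∷_) vs ++_) (concatMap-prepend xs vs)

allVecs-suc : ∀ {A : Set} (xs : List A) k →
              allVecs xs (suc k) ≡ cartesianProductWith Vec._∷_ xs (allVecs xs k)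
allVecs-suc xs k = concatMap-prepend xs (allVecs xs k)

allVecs-unique : ∀ {A : Set} {xs : List A} k → Unique xs → Unique (allVecs xs k)
allVecs-unique           zero    xs! = All.[] ∷ []
allVecs-unique {xs = xs} (suc k) xs! rewrite allVecs-suc xs k =
  Unique.cartesianProductWith⁺ Vec._∷_ Vecₚ.∷-injective xs! (allVecs-unique k xs!)

∈-allVecs : ∀ {n k} (v : Vec (Fin n) k) → v ∈ allVecs (allFin n) k
∈-allVecs               Vec.[]        = here refl
∈-allVecs {n} {suc k} (i Vec.∷ v) rewrite allVecs-suc (allFin n) k =
  ∈-cartesianProductWith⁺ Vec._∷_ (∈-allFin i) (∈-allVecs v)

countBelow : ℕ → (ℕ → Bool) → ℕ
countBelow zero    p = 0
countBelow (suc n) p = (if p 0 then 1 else 0) + countBelow n (p ∘ suc)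

length-filter-tabulate : ∀ {A : Set} {P : A → Set} (P? : Decidable P) {n} (f : Fin n → A)
                         (p : ℕ → Bool) → (∀ i → does (P? (f i)) ≡ p (toℕ i)) →
                         length (filter P? (tabulate f)) ≡ countBelow n p
length-filter-tabulate P? {zero}  f p agree = refl
length-filter-tabulate P? {suc n} f p agree with does (P? (f Fin.zero)) | p 0 | agree Fin.zero
... | false | _ | refl = length-filter-tabulate P? (f ∘ Fin.suc) (p ∘ suc) (agree ∘ Fin.suc)
... | true  | _ | refl = cong suc (length-filter-tabulate P? (f ∘ Fin.suc) (p ∘ suc) (agree ∘ Fin.suc))

-- Four-term linear recurrences

module FourTermRecurrence (p q r s : ℕ) where

  IsSolution : (ℕ → ℕ) → Set
  IsSolution x = ∀ m → x (4 + m) ≡ p * x (3 + m) + q * x (2 + m) + r * x (1 + m) + s * x m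

  bilinear : (ℕ → ℕ) → ℕ → ℕ → ℕ
  bilinear x m n =
    x (3 + m) * x (3 + n)
    + x (2 + m) * (q * x (2 + n) + r * x (1 + n) + s * x n)
    + x (1 + m) * (r * x (2 + n) + s * x (1 + n))
    + s * x (2 + n) * x m

  bilinear-suc : ∀ {x} → IsSolution x → ∀ m n → bilinear x m (suc n) ≡ bilinear x (suc m) n
  bilinear-suc {x} x-rec m n rewrite x-rec m | x-rec n =
    exchange p q r s (x (3 + m)) (x (2 + m)) (x (1 + m)) (x m) (x (3 + n)) (x (2 + n)) (x (1 + n)) (x n)
    where
    exchange : ∀ p q r s y₃ y₂ y₁ y₀ z₃ z₂ z₁ z₀ →
      y₃ * (p * z₃ + q * z₂ + r * z₁ + s * z₀) + y₂ * (q * z₃ + r * z₂ + s * z₁)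
      + y₁ * (r * z₃ + s * z₂) + s * z₃ * y₀
      ≡ (p * y₃ + q * y₂ + r * y₁ + s * y₀) * z₃ + y₃ * (q * z₂ + r * z₁ + s * z₀)
        + y₂ * (r * z₂ + s * z₁) + s * z₂ * y₁
    exchange = solve-∀

  addition-formula : ∀ {x} → IsSolution x → x 0 ≡ 0 → x 1 ≡ 0 → x 2 ≡ 0 → x 3 ≡ 1 →
                     ∀ m n → x (3 + (m + n)) ≡ bilinear x m n
  addition-formula {x} x-rec e₀ e₁ e₂ e₃ zero n rewrite e₀ | e₁ | e₂ | e₃ =
    initial q r s (x (3 + n)) (x (2 + n)) (x (1 + n)) (x n)
    where
    initial : ∀ q r s z₃ z₂ z₁ z₀ →
      z₃ ≡ 1 * z₃ + 0 * (q * z₂ + r * z₁ + s * z₀) + 0 * (r * z₂ + s * z₁) + s * z₂ * 0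
    initial = solve-∀
  addition-formula {x} x-rec e₀ e₁ e₂ e₃ (suc m) n = begin
    x (3 + (suc m + n))  ≡⟨ cong (λ k → x (3 + k)) (+-suc m n) ⟨
    x (3 + (m + suc n))  ≡⟨ addition-formula x-rec e₀ e₁ e₂ e₃ m (suc n) ⟩
    bilinear x m (suc n) ≡⟨ bilinear-suc x-rec m n ⟩
    bilinear x (suc m) n ∎
    where open ≡-Reasoning

-- Words of blocks

-- On its own hexagons 0, …, size β − 1 a block is: mono {0}; slant {0,1};
-- arch {0,2} with the monomer {1}; cross {0,2} and {1,3}.
data Block : Set where
  mono slant arch cross : Block

size : Block → ℕ
size mono  = 1
size slant = 2
size arch  = 3
size cross = 4

span : List Block → ℕ
span w = sum (map size w)

headSize : List Block → ℕ
headSize []      = 0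
headSize (β ∷ _) = size β

-- wordsᵏ n lists the words of span n + k − 1 whose first block has size at least k.
mutual
  words : ℕ → List (List Block)
  words zero    = [] ∷ []
  words (suc n) = map (mono ∷_) (words n) ++ words² n

  words² : ℕ → List (List Block)
  words² zero    = []
  words² (suc n) = map (slant ∷_) (words n) ++ words³ n

  words³ : ℕ → List (List Block)
  words³ zero    = []
  words³ (suc n) = map (arch ∷_) (words n) ++ words⁴ n

  words⁴ : ℕ → List (List Block)
  words⁴ zero    = []
  words⁴ (suc n) = map (cross ∷_) (words n)

span-∈-prepend : ∀ β {m ws w} → (∀ {v} → v ∈ ws → span v ≡ m) → w ∈ map (β ∷_) ws → span w ≡ size β + m
span-∈-prepend β sound w∈ with ∈-map⁻ (β ∷_) w∈
... | _ , v∈ , refl = cong (size β +_) (sound v∈)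

mutual
  words-sound : ∀ n {w} → w ∈ words n → span w ≡ n
  words-sound zero    (here refl) = refl
  words-sound (suc n) w∈ with ∈-++⁻ (map (mono ∷_) (words n)) w∈
  ... | inj₁ w∈₁ = span-∈-prepend mono (words-sound n) w∈₁
  ... | inj₂ w∈₂ = words²-sound n w∈₂

  words²-sound : ∀ n {w} → w ∈ words² n → span w ≡ suc n
  words²-sound (suc n) w∈ with ∈-++⁻ (map (slant ∷_) (words n)) w∈
  ... | inj₁ w∈₁ = span-∈-prepend slant (words-sound n) w∈₁
  ... | inj₂ w∈₂ = words³-sound n w∈₂

  words³-sound : ∀ n {w} → w ∈ words³ n → span w ≡ suc (suc n)
  words³-sound (suc n) w∈ with ∈-++⁻ (map (arch ∷_) (words n)) w∈
  ... | inj₁ w∈₁ = span-∈-prepend arch (words-sound n) w∈₁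
  ... | inj₂ w∈₂ = words⁴-sound n w∈₂

  words⁴-sound : ∀ n {w} → w ∈ words⁴ n → span w ≡ suc (suc (suc n))
  words⁴-sound (suc n) w∈ = span-∈-prepend cross (words-sound n) w∈

words-complete : ∀ w → w ∈ words (span w)
words-complete []          = here refl
words-complete (mono ∷ w)  = ∈-++⁺ˡ (∈-map⁺ (mono ∷_) (words-complete w))
words-complete (slant ∷ w) =
  ∈-++⁺ʳ (map (mono ∷_) (words (1 + span w))) (∈-++⁺ˡ (∈-map⁺ (slant ∷_) (words-complete w)))
words-complete (arch ∷ w)  =
  ∈-++⁺ʳ (map (mono ∷_) (words (2 + span w))) (∈-++⁺ʳ (map (slant ∷_) (words (1 + span w)))
    (∈-++⁺ˡ (∈-map⁺ (arch ∷_) (words-complete w))))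
words-complete (cross ∷ w) =
  ∈-++⁺ʳ (map (mono ∷_) (words (3 + span w))) (∈-++⁺ʳ (map (slant ∷_) (words (2 + span w)))
    (∈-++⁺ʳ (map (arch ∷_) (words (1 + span w))) (∈-map⁺ (cross ∷_) (words-complete w))))

mutual
  words²-headSize : ∀ n {w} → w ∈ words² n → 1 < headSize w
  words²-headSize (suc n) w∈ with ∈-++⁻ (map (slant ∷_) (words n)) w∈
  ... | inj₁ w∈₁ with ∈-map⁻ (slant ∷_) w∈₁
  ...   | _ , _ , refl = ≤-refl
  words²-headSize (suc n) w∈ | inj₂ w∈₂ = <-trans (n<1+n 1) (words³-headSize n w∈₂)

  words³-headSize : ∀ n {w} → w ∈ words³ n → 2 < headSize w
  words³-headSize (suc n) w∈ with ∈-++⁻ (map (arch ∷_) (words n)) w∈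
  ... | inj₁ w∈₁ with ∈-map⁻ (arch ∷_) w∈₁
  ...   | _ , _ , refl = ≤-refl
  words³-headSize (suc n) w∈ | inj₂ w∈₂ = <-trans (n<1+n 2) (words⁴-headSize n w∈₂)

  words⁴-headSize : ∀ n {w} → w ∈ words⁴ n → 3 < headSize w
  words⁴-headSize (suc n) w∈ with ∈-map⁻ (cross ∷_) w∈
  ... | _ , _ , refl = ≤-refl

prepend-unique : ∀ β {ws ws′ : List (List Block)} → Unique ws → Unique ws′ →
                 (∀ {w} → w ∈ ws′ → size β < headSize w) → Unique (map (β ∷_) ws ++ ws′)
prepend-unique β {ws} {ws′} ws! ws′! larger =
  Unique.++⁺ (Unique.map⁺ List.∷-injectiveʳ ws!) ws′! disjoint
  where
  disjoint : ∀ {w} → ¬ (w ∈ map (β ∷_) ws × w ∈ ws′)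
  disjoint (w∈₁ , w∈₂) with ∈-map⁻ (β ∷_) w∈₁
  ... | _ , _ , refl = <-irrefl refl (larger w∈₂)

mutual
  words-unique : ∀ n → Unique (words n)
  words-unique zero    = All.[] ∷ []
  words-unique (suc n) = prepend-unique mono (words-unique n) (words²-unique n) (words²-headSize n)

  words²-unique : ∀ n → Unique (words² n)
  words²-unique zero    = []
  words²-unique (suc n) = prepend-unique slant (words-unique n) (words³-unique n) (words³-headSize n)

  words³-unique : ∀ n → Unique (words³ n)
  words³-unique zero    = []
  words³-unique (suc n) = prepend-unique arch (words-unique n) (words⁴-unique n) (words⁴-headSize n)

  words⁴-unique : ∀ n → Unique (words⁴ n)
  words⁴-unique zero    = []
  words⁴-unique (suc n) = Unique.map⁺ List.∷-injectiveʳ (words-unique n)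

-- Tilings as partner maps on ℕ

Near : ℕ → ℕ → Set
Near j k = k ≡ j ⊎ (∣ j - k ∣ ≡ 1 ⊎ ∣ j - k ∣ ≡ 2)

near-+ : ∀ s {j k} → Near j k → Near (s + j) (s + k)
near-+ s         (inj₁ k≡j) = inj₁ (cong (s +_) k≡j)
near-+ s {j} {k} (inj₂ d)   rewrite ∣m+n-m+o∣≡∣n-o∣ s j k = inj₂ d

near-+⁻ : ∀ s {j k} → Near (s + j) (s + k) → Near j k
near-+⁻ s         (inj₁ k≡j) = inj₁ (+-cancelˡ-≡ s _ _ k≡j)
near-+⁻ s {j} {k} (inj₂ d)   rewrite ∣m+n-m+o∣≡∣n-o∣ s j k = inj₂ d

record IsTilingMap (n : ℕ) (F : ℕ → ℕ) : Set where
  field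
    involutive : ∀ j → F (F j) ≡ j
    near       : ∀ j → Near j (F j)
    fixed      : ∀ j → n ≤ j → F j ≡ j

_⊕_ : Block → (ℕ → ℕ) → ℕ → ℕ
(mono  ⊕ g) 0                         = 0
(mono  ⊕ g) (suc j)                   = 1 + g j
(slant ⊕ g) 0                         = 1
(slant ⊕ g) 1                         = 0
(slant ⊕ g) (suc (suc j))             = 2 + g j
(arch  ⊕ g) 0                         = 2
(arch  ⊕ g) 1                         = 1
(arch  ⊕ g) 2                         = 0
(arch  ⊕ g) (suc (suc (suc j)))       = 3 + g j
(cross ⊕ g) 0                         = 2
(cross ⊕ g) 1                         = 3
(cross ⊕ g) 2                         = 0
(cross ⊕ g) 3                         = 1
(cross ⊕ g) (suc (suc (suc (suc j)))) = 4 + g j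

partner : List Block → ℕ → ℕ
partner []      = id
partner (β ∷ w) = β ⊕ partner w

⊕-shift : ∀ β g j → (β ⊕ g) (size β + j) ≡ size β + g j
⊕-shift mono  g j = refl
⊕-shift slant g j = refl
⊕-shift arch  g j = refl
⊕-shift cross g j = refl

⊕-involutive : ∀ β {g} → (∀ j → g (g j) ≡ j) → ∀ j → (β ⊕ g) ((β ⊕ g) j) ≡ j
⊕-involutive mono  inv 0                         = refl
⊕-involutive mono  inv (suc j)                   = cong (1 +_) (inv j)
⊕-involutive slant inv 0                         = refl
⊕-involutive slant inv 1                         = refl
⊕-involutive slant inv (suc (suc j))             = cong (2 +_) (inv j)
⊕-involutive arch  inv 0                         = refl
⊕-involutive arch  inv 1                         = refl
⊕-involutive arch  inv 2                         = refl
⊕-involutive arch  inv (suc (suc (suc j)))       = cong (3 +_) (inv j)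
⊕-involutive cross inv 0                         = refl
⊕-involutive cross inv 1                         = refl
⊕-involutive cross inv 2                         = refl
⊕-involutive cross inv 3                         = refl
⊕-involutive cross inv (suc (suc (suc (suc j)))) = cong (4 +_) (inv j)

⊕-near : ∀ β {g} → (∀ j → Near j (g j)) → ∀ j → Near j ((β ⊕ g) j)
⊕-near mono  near 0                         = inj₁ refl
⊕-near mono  near (suc j)                   = near-+ 1 (near j)
⊕-near slant near 0                         = inj₂ (inj₁ refl)
⊕-near slant near 1                         = inj₂ (inj₁ refl)
⊕-near slant near (suc (suc j))             = near-+ 2 (near j)
⊕-near arch  near 0                         = inj₂ (inj₂ refl)
⊕-near arch  near 1                         = inj₁ refl
⊕-near arch  near 2                         = inj₂ (inj₂ refl)
⊕-near arch  near (suc (suc (suc j)))       = near-+ 3 (near j)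
⊕-near cross near 0                         = inj₂ (inj₂ refl)
⊕-near cross near 1                         = inj₂ (inj₂ refl)
⊕-near cross near 2                         = inj₂ (inj₂ refl)
⊕-near cross near 3                         = inj₂ (inj₂ refl)
⊕-near cross near (suc (suc (suc (suc j)))) = near-+ 4 (near j)

⊕-fixed : ∀ β {m g} → (∀ j → m ≤ j → g j ≡ j) → ∀ j → size β + m ≤ j → (β ⊕ g) j ≡ j
⊕-fixed β {m} {g} fixed j s+m≤j = begin
  (β ⊕ g) j            ≡⟨ cong (β ⊕ g) s+i≡j ⟨
  (β ⊕ g) (size β + i) ≡⟨ ⊕-shift β g i ⟩
  size β + g i         ≡⟨ cong (size β +_) (fixed i m≤i) ⟩
  size β + i           ≡⟨ s+i≡j ⟩
  j                    ∎
  where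
  open ≡-Reasoning
  i = j ∸ size β
  s+i≡j : size β + i ≡ j
  s+i≡j = m+[n∸m]≡n (≤-trans (m≤m+n (size β) m) s+m≤j)
  m≤i : m ≤ i
  m≤i = +-cancelˡ-≤ (size β) m i (subst (size β + m ≤_) (sym s+i≡j) s+m≤j)

⊕-isTilingMap : ∀ β {m g} → IsTilingMap m g → IsTilingMap (size β + m) (β ⊕ g)
⊕-isTilingMap β t = record
  { involutive = ⊕-involutive β involutive
  ; near       = ⊕-near β near
  ; fixed      = ⊕-fixed β fixed
  }
  where open IsTilingMap t

partner-isTilingMap : ∀ w → IsTilingMap (span w) (partner w)
partner-isTilingMap []      =
  record { involutive = λ _ → refl ; near = λ _ → inj₁ refl ; fixed = λ _ _ → refl }
partner-isTilingMap (β ∷ w) = ⊕-isTilingMap β (partner-isTilingMap w)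

firstBlock : ℕ → ℕ → Block
firstBlock 0             _ = mono
firstBlock 1             _ = slant
firstBlock (suc (suc _)) 3 = cross
firstBlock (suc (suc _)) _ = arch

firstBlock-⊕ : ∀ β g → firstBlock ((β ⊕ g) 0) ((β ⊕ g) 1) ≡ β
firstBlock-⊕ mono  g = refl
firstBlock-⊕ slant g = refl
firstBlock-⊕ arch  g = refl
firstBlock-⊕ cross g = refl

0<size : ∀ β → 0 < size β
0<size mono  = z<s
0<size slant = z<s
0<size arch  = z<s
0<size cross = z<s

partner-injective : ∀ w w′ → span w ≡ span w′ → partner w ≗ partner w′ → w ≡ w′
partner-injective []      []        _  _ = refl
partner-injective []      (β ∷ w′)  eq _ = ⊥-elim (<⇒≢ (≤-trans (0<size β) (m≤m+n _ _)) eq)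
partner-injective (β ∷ w) []        eq _ = ⊥-elim (<⇒≢ (≤-trans (0<size β) (m≤m+n _ _)) (sym eq))
partner-injective (β ∷ w) (β′ ∷ w′) eq agree
  with trans (sym (firstBlock-⊕ β _))
             (trans (cong₂ firstBlock (agree 0) (agree 1)) (firstBlock-⊕ β′ _))
... | refl = cong (β ∷_) (partner-injective w w′ (+-cancelˡ-≡ (size β) _ _ eq) tails-agree)
  where
  tails-agree : partner w ≗ partner w′
  tails-agree j = +-cancelˡ-≡ (size β) _ _
    (trans (sym (⊕-shift β (partner w) j)) (trans (agree (size β + j)) (⊕-shift β (partner w′) j)))

StartsWith : Block → (ℕ → ℕ) → Set
StartsWith mono  F = F 0 ≡ 0
StartsWith slant F = F 0 ≡ 1 × F 1 ≡ 0
StartsWith arch  F = F 0 ≡ 2 × F 1 ≡ 1 × F 2 ≡ 0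
StartsWith cross F = F 0 ≡ 2 × F 1 ≡ 3 × F 2 ≡ 0 × F 3 ≡ 1

startsWith-closed : ∀ β {F} → StartsWith β F → ∀ k → k < size β → F k < size β
startsWith-closed mono  e                    0 _ = subst (_< 1) (sym e) z<s
startsWith-closed slant (e₀ , e₁)            0 _ = subst (_< 2) (sym e₀) (s<s z<s)
startsWith-closed slant (e₀ , e₁)            1 _ = subst (_< 2) (sym e₁) z<s
startsWith-closed arch  (e₀ , e₁ , e₂)       0 _ = subst (_< 3) (sym e₀) (s<s (s<s z<s))
startsWith-closed arch  (e₀ , e₁ , e₂)       1 _ = subst (_< 3) (sym e₁) (s<s z<s)
startsWith-closed arch  (e₀ , e₁ , e₂)       2 _ = subst (_< 3) (sym e₂) z<s
startsWith-closed cross (e₀ , e₁ , e₂ , e₃) 0 _ = subst (_< 4) (sym e₀) (s<s (s<s z<s))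
startsWith-closed cross (e₀ , e₁ , e₂ , e₃) 1 _ = subst (_< 4) (sym e₁) (s<s (s<s (s<s z<s)))
startsWith-closed cross (e₀ , e₁ , e₂ , e₃) 2 _ = subst (_< 4) (sym e₂) z<s
startsWith-closed cross (e₀ , e₁ , e₂ , e₃) 3 _ = subst (_< 4) (sym e₃) (s<s z<s)
startsWith-closed mono  _ (suc _)                   (s<s ())
startsWith-closed slant _ (suc (suc _))             (s<s (s<s ()))
startsWith-closed arch  _ (suc (suc (suc _)))       (s<s (s<s (s<s ())))
startsWith-closed cross _ (suc (suc (suc (suc _)))) (s<s (s<s (s<s (s<s ()))))

startsWith-⊕ : ∀ β {F g} → StartsWith β F → (∀ i → F (size β + i) ≡ size β + g i) → F ≗ β ⊕ g
startsWith-⊕ mono  e                    shift 0                         = e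
startsWith-⊕ mono  e                    shift (suc j)                   = shift j
startsWith-⊕ slant (e₀ , e₁)            shift 0                         = e₀
startsWith-⊕ slant (e₀ , e₁)            shift 1                         = e₁
startsWith-⊕ slant (e₀ , e₁)            shift (suc (suc j))             = shift j
startsWith-⊕ arch  (e₀ , e₁ , e₂)       shift 0                         = e₀
startsWith-⊕ arch  (e₀ , e₁ , e₂)       shift 1                         = e₁
startsWith-⊕ arch  (e₀ , e₁ , e₂)       shift 2                         = e₂
startsWith-⊕ arch  (e₀ , e₁ , e₂)       shift (suc (suc (suc j)))       = shift j
startsWith-⊕ cross (e₀ , e₁ , e₂ , e₃) shift 0                         = e₀
startsWith-⊕ cross (e₀ , e₁ , e₂ , e₃) shift 1                         = e₁
startsWith-⊕ cross (e₀ , e₁ , e₂ , e₃) shift 2                         = e₂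
startsWith-⊕ cross (e₀ , e₁ , e₂ , e₃) shift 3                         = e₃
startsWith-⊕ cross (e₀ , e₁ , e₂ , e₃) shift (suc (suc (suc (suc j)))) = shift j

module _ {n F} (t : IsTilingMap n F) where
  open IsTilingMap t

  swap : ∀ {j k} → F j ≡ k → F k ≡ j
  swap {j} Fj≡k = trans (cong F (sym Fj≡k)) (involutive j)

  moved⇒< : ∀ {j k} → F j ≡ k → k ≢ j → j < n
  moved⇒< Fj≡k k≢j = ≰⇒> (λ n≤j → k≢j (trans (sym Fj≡k) (fixed _ n≤j)))

  <-closed : ∀ {j} → j < n → F j < n
  <-closed {j} j<n = ≰⇒> λ n≤Fj →
    <⇒≱ j<n (subst (n ≤_) (trans (sym (fixed (F j) n≤Fj)) (involutive j)) n≤Fj)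

  startsWith-exists : 0 < n → ∃[ β ] size β ≤ n × StartsWith β F
  startsWith-exists 0<n with F 0 in e₀ | near 0
  ... | 0 | _ = mono , 0<n , e₀
  ... | 1 | _ = slant , moved⇒< (swap e₀) (λ ()) , e₀ , swap e₀
  ... | 2 | _ = after-2 (swap e₀)
    where
    after-2 : F 2 ≡ 0 → ∃[ β ] size β ≤ n × StartsWith β F
    after-2 e₂ with F 1 in e₁ | near 1
    ... | 0 | _ = case trans (sym e₀) (swap e₁) of λ ()
    ... | 1 | _ = arch , moved⇒< e₂ (λ ()) , e₀ , e₁ , e₂
    ... | 2 | _ = case trans (sym e₂) (swap e₁) of λ ()
    ... | 3 | _ = cross , moved⇒< (swap e₁) (λ ()) , e₀ , e₁ , e₂ , swap e₁
    ... | suc (suc (suc (suc _))) | inj₂ (inj₁ ())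
    ... | suc (suc (suc (suc _))) | inj₂ (inj₂ ())
  ... | suc (suc (suc _)) | inj₂ (inj₁ ())
  ... | suc (suc (suc _)) | inj₂ (inj₂ ())

module _ {n F} (t : IsTilingMap n F) {s} (closed : ∀ k → k < s → F k < s) where
  open IsTilingMap t

  unshift : ℕ → ℕ
  unshift i = F (s + i) ∸ s

  -- Being an involution, F maps the complement of [0, s) into itself.
  shift-unshift : ∀ i → F (s + i) ≡ s + unshift i
  shift-unshift i = sym (m+[n∸m]≡n (≮⇒≥ F[s+i]≮s))
    where
    F[s+i]≮s : ¬ F (s + i) < s
    F[s+i]≮s F[s+i]<s =
      <-irrefl refl (<-≤-trans (subst (_< s) (involutive (s + i)) (closed _ F[s+i]<s)) (m≤m+n s i))

  unshift-isTilingMap : IsTilingMap (n ∸ s) unshift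
  unshift-isTilingMap = record
    { involutive = λ i → begin
        F (s + unshift i) ∸ s ≡⟨ cong (λ j → F j ∸ s) (shift-unshift i) ⟨
        F (F (s + i)) ∸ s     ≡⟨ cong (_∸ s) (involutive (s + i)) ⟩
        s + i ∸ s             ≡⟨ m+n∸m≡n s i ⟩
        i                     ∎
    ; near  = λ i → near-+⁻ s (subst (Near (s + i)) (shift-unshift i) (near (s + i)))
    ; fixed = λ i n∸s≤i → begin
        F (s + i) ∸ s         ≡⟨ cong (_∸ s) (fixed (s + i) (≤-trans (m≤n+m∸n n s) (+-monoʳ-≤ s n∸s≤i))) ⟩
        s + i ∸ s             ≡⟨ m+n∸m≡n s i ⟩
        i                     ∎
    }
    where open ≡-Reasoning

tilingMap⇒partner : ∀ n {F} → IsTilingMap n F → ∃[ w ] span w ≡ n × F ≗ partner w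
tilingMap⇒partner = <-rec _ parse
  where
  parse : ∀ n → (∀ {m} → m < n → ∀ {F} → IsTilingMap m F → ∃[ w ] span w ≡ m × F ≗ partner w) →
          ∀ {F} → IsTilingMap n F → ∃[ w ] span w ≡ n × F ≗ partner w
  parse zero    _       t = [] , refl , λ j → IsTilingMap.fixed t j z≤n
  parse (suc n) shorter t with startsWith-exists t z<s
  ... | β , β≤n , starts =
    let closed               = startsWith-closed β starts
        w , span≡ , unshift≗ = shorter (∸-monoʳ-< (0<size β) β≤n) (unshift-isTilingMap t closed)
    in  β ∷ w
      , trans (cong (size β +_) span≡) (m+[n∸m]≡n β≤n)
      , startsWith-⊕ β starts (λ i → trans (shift-unshift t closed i) (cong (size β +_) (unshift≗ i)))

-- From partner maps to tilings of H_n

toℕ-or-beyond : ∀ {n} (P : ℕ → Set) → (∀ (i : Fin n) → P (toℕ i)) → (∀ j → n ≤ j → P j) → ∀ j → P j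
toℕ-or-beyond {n} P below beyond j with j <? n
... | yes j<n = subst P (Finₚ.toℕ-fromℕ< j<n) (below (fromℕ< j<n))
... | no  j≮n = beyond j (≮⇒≥ j≮n)

extend : ∀ {n} → Vec (Fin n) n → ℕ → ℕ
extend {n} v j with j <? n
... | yes j<n = toℕ (Vec.lookup v (fromℕ< j<n))
... | no  _   = j

extend-toℕ : ∀ {n} (v : Vec (Fin n) n) i → extend v (toℕ i) ≡ toℕ (Vec.lookup v i)
extend-toℕ {n} v i with toℕ i <? n
... | yes i<n = cong (toℕ ∘ Vec.lookup v) (Finₚ.fromℕ<-toℕ i i<n)
... | no  i≮n = ⊥-elim (i≮n (Finₚ.toℕ<n i))

extend-fixed : ∀ {n} (v : Vec (Fin n) n) j → n ≤ j → extend v j ≡ j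
extend-fixed {n} v j n≤j with j <? n
... | yes j<n = ⊥-elim (<⇒≱ j<n n≤j)
... | no  _   = refl

extend-isTilingMap : ∀ {n} (v : Vec (Fin n) n) → IsTiling (Vec.lookup v) → IsTilingMap n (extend v)
extend-isTilingMap {n} v tiling = record
  { involutive = toℕ-or-beyond (λ j → F (F j) ≡ j) involutive-toℕ
                   (λ j n≤j → trans (cong F (extend-fixed v j n≤j)) (extend-fixed v j n≤j))
  ; near       = toℕ-or-beyond (λ j → Near j (F j)) near-toℕ (λ j n≤j → inj₁ (extend-fixed v j n≤j))
  ; fixed      = extend-fixed v
  }
  where
  F = extend v
  f = Vec.lookup v
  involutive-toℕ : ∀ i → F (F (toℕ i)) ≡ toℕ i
  involutive-toℕ i rewrite extend-toℕ v i | extend-toℕ v (f i) = cong toℕ (proj₁ (tiling i))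
  near-toℕ : ∀ i → Near (toℕ i) (F (toℕ i))
  near-toℕ i with proj₂ (tiling i)
  ... | inj₁ fi≡i     = inj₁ (trans (extend-toℕ v i) (cong toℕ fi≡i))
  ... | inj₂ adjacent =
    inj₂ (subst (λ k → ∣ toℕ i - k ∣ ≡ 1 ⊎ ∣ toℕ i - k ∣ ≡ 2) (sym (extend-toℕ v i)) adjacent)

clamp : ∀ {n} → Fin n → ℕ → Fin n
clamp {n} default j with j <? n
... | yes j<n = fromℕ< j<n
... | no  _   = default

toℕ-clamp : ∀ {n} (default : Fin n) {j} → j < n → toℕ (clamp default j) ≡ j
toℕ-clamp {n} default {j} j<n with j <? n
... | yes j<n′ = Finₚ.toℕ-fromℕ< j<n′
... | no  j≮n  = ⊥-elim (j≮n j<n)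

restrict : ∀ n → (ℕ → ℕ) → Vec (Fin n) n
restrict n F = Vec.tabulate (λ i → clamp i (F (toℕ i)))

restrict-cong : ∀ n {F G} → F ≗ G → restrict n F ≡ restrict n G
restrict-cong n F≗G = Vecₚ.tabulate-cong (λ i → cong (clamp i) (F≗G (toℕ i)))

restrict-extend : ∀ {n} (v : Vec (Fin n) n) → restrict n (extend v) ≡ v
restrict-extend v = trans (Vecₚ.tabulate-cong λ i → Finₚ.toℕ-injective (begin
    toℕ (clamp i (extend v (toℕ i)))     ≡⟨ cong (toℕ ∘ clamp i) (extend-toℕ v i) ⟩
    toℕ (clamp i (toℕ (Vec.lookup v i))) ≡⟨ toℕ-clamp i (Finₚ.toℕ<n _) ⟩
    toℕ (Vec.lookup v i)                 ∎))
  (Vecₚ.tabulate∘lookup v)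
  where open ≡-Reasoning

monomerCount : ℕ → (ℕ → ℕ) → ℕ
monomerCount n F = countBelow n (λ j → does (F j ℕ.≟ j))

dimerCount : ℕ → (ℕ → ℕ) → ℕ
dimerCount n F = countBelow n (λ j → does (j <? F j))

module _ {n F} (t : IsTilingMap n F) where
  open IsTilingMap t
  private f = Vec.lookup (restrict n F)

  toℕ-restrict : ∀ i → toℕ (f i) ≡ F (toℕ i)
  toℕ-restrict i =
    trans (cong toℕ (Vecₚ.lookup∘tabulate _ i)) (toℕ-clamp i (<-closed t (Finₚ.toℕ<n i)))

  restrict-isTiling : IsTiling f
  restrict-isTiling i = Finₚ.toℕ-injective involutive-toℕ , near-toℕ
    where
    involutive-toℕ : toℕ (f (f i)) ≡ toℕ i
    involutive-toℕ = trans (toℕ-restrict (f i)) (trans (cong F (toℕ-restrict i)) (involutive (toℕ i)))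
    near-toℕ : f i ≡ i ⊎ Adjacent i (f i)
    near-toℕ with near (toℕ i)
    ... | inj₁ Fi≡i     = inj₁ (Finₚ.toℕ-injective (trans (toℕ-restrict i) Fi≡i))
    ... | inj₂ adjacent =
      inj₂ (subst (λ k → ∣ toℕ i - k ∣ ≡ 1 ⊎ ∣ toℕ i - k ∣ ≡ 2) (sym (toℕ-restrict i)) adjacent)

  monomers-restrict : monomers f ≡ monomerCount n F
  monomers-restrict = length-filter-tabulate (λ i → f i Finₚ.≟ i) id _ λ i →
    does-⇔ (mk⇔ (λ fi≡i → trans (sym (toℕ-restrict i)) (cong toℕ fi≡i))
                (λ Fi≡i → Finₚ.toℕ-injective (trans (toℕ-restrict i) Fi≡i)))
           (f i Finₚ.≟ i) (F (toℕ i) ℕ.≟ toℕ i)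

  dimers-restrict : dimers f ≡ dimerCount n F
  dimers-restrict = length-filter-tabulate (λ i → toℕ i <? toℕ (f i)) id _ λ i →
    cong (λ k → does (toℕ i <? k)) (toℕ-restrict i)

restrict-injective : ∀ {n F G} → IsTilingMap n F → IsTilingMap n G →
                     restrict n F ≡ restrict n G → F ≗ G
restrict-injective {n} {F} {G} tF tG eq = toℕ-or-beyond (λ j → F j ≡ G j)
  (λ i → trans (sym (toℕ-restrict tF i))
               (trans (cong (λ v → toℕ (Vec.lookup v i)) eq) (toℕ-restrict tG i)))
  (λ j n≤j → trans (IsTilingMap.fixed tF j n≤j) (sym (IsTilingMap.fixed tG j n≤j)))

encode : ∀ n → List Block → Vec (Fin n) n
encode n w = restrict n (partner w)

word-isTilingMap : ∀ n {w} → w ∈ words n → IsTilingMap n (partner w)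
word-isTilingMap n {w} w∈ =
  subst (λ k → IsTilingMap k (partner w)) (words-sound n w∈) (partner-isTilingMap w)

tilings↭encodings : ∀ n → tilings n ↭ map (encode n) (words n)
tilings↭encodings n =
  ∼bag⇒↭ (unique∧set⇒bag tilings-unique encodings-unique (mk⇔ decode encoding-isTiling))
  where
  lookup-isTiling? = λ (v : Vec (Fin n) n) → isTiling? (Vec.lookup v)

  tilings-unique : Unique (tilings n)
  tilings-unique = Unique.filter⁺ lookup-isTiling? (allVecs-unique n (Unique.allFin⁺ n))

  encodings-unique : Unique (map (encode n) (words n))
  encodings-unique = map⁺-local (encode n)
    (λ {w} {w′} w∈ w′∈ eq →
       partner-injective w w′ (trans (words-sound n w∈) (sym (words-sound n w′∈)))
         (restrict-injective (word-isTilingMap n w∈) (word-isTilingMap n w′∈) eq))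
    (words-unique n)

  decode : ∀ {v} → v ∈ tilings n → v ∈ map (encode n) (words n)
  decode {v} v∈ =
    let tiling               = proj₂ (∈-filter⁻ lookup-isTiling? {xs = allVecs (allFin n) n} v∈)
        w , span≡ , extend≗ = tilingMap⇒partner n (extend-isTilingMap v tiling)
    in  subst (_∈ map (encode n) (words n)) (trans (sym (restrict-cong n extend≗)) (restrict-extend v))
          (∈-map⁺ (encode n) (subst (λ k → w ∈ words k) span≡ (words-complete w)))

  encoding-isTiling : ∀ {v} → v ∈ map (encode n) (words n) → v ∈ tilings n
  encoding-isTiling v∈ with ∈-map⁻ (encode n) v∈
  ... | w , w∈ , refl =
    ∈-filter⁺ lookup-isTiling? (∈-allVecs _) (restrict-isTiling (word-isTilingMap n w∈))

-- Colored tilings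

module Colored (a b : ℕ) where

  weight : ℕ → (ℕ → ℕ) → ℕ
  weight n F = a ^ monomerCount n F * b ^ dimerCount n F

  blockWeight : Block → ℕ
  blockWeight mono  = a
  blockWeight slant = b
  blockWeight arch  = a * b
  blockWeight cross = b ^ 2

  weight-⊕ : ∀ β m g → weight (size β + m) (β ⊕ g) ≡ blockWeight β * weight m g
  weight-⊕ mono  m g = *-assoc a _ _
  weight-⊕ slant m g = rearrange b (a ^ monomerCount m g) (b ^ dimerCount m g)
    where
    rearrange : ∀ b x y → x * (b * y) ≡ b * (x * y)
    rearrange = solve-∀
  weight-⊕ arch  m g = rearrange a b (a ^ monomerCount m g) (b ^ dimerCount m g)
    where
    rearrange : ∀ a b x y → a * x * (b * y) ≡ a * b * (x * y)
    rearrange = solve-∀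
  weight-⊕ cross m g = rearrange b (a ^ monomerCount m g) (b ^ dimerCount m g)
    where
    rearrange : ∀ b x y → x * (b * (b * y)) ≡ b * (b * 1) * (x * y)
    rearrange = solve-∀

  wordSum : ℕ → List (List Block) → ℕ
  wordSum n ws = sum (map (λ w → weight n (partner w)) ws)

  h≡wordSum : ∀ n → h a b n ≡ wordSum n (words n)
  h≡wordSum n = begin
    sum (map tilingWeight (tilings n))
      ≡⟨ sum-↭ (↭.map⁺ tilingWeight (tilings↭encodings n)) ⟩
    sum (map tilingWeight (map (encode n) (words n)))
      ≡⟨ cong sum (List.map-∘ (words n)) ⟨
    sum (map (tilingWeight ∘ encode n) (words n))
      ≡⟨ cong sum (List.map-cong-local (All.tabulate weight-encode)) ⟩
    wordSum n (words n)
      ∎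
    where
    open ≡-Reasoning
    tilingWeight : Vec (Fin n) n → ℕ
    tilingWeight v = a ^ monomers (Vec.lookup v) * b ^ dimers (Vec.lookup v)
    weight-encode : ∀ {w} → w ∈ words n → tilingWeight (encode n w) ≡ weight n (partner w)
    weight-encode w∈ = cong₂ (λ k l → a ^ k * b ^ l) (monomers-restrict t) (dimers-restrict t)
      where t = word-isTilingMap n w∈

  wordSum-++ : ∀ n ws ws′ → wordSum n (ws ++ ws′) ≡ wordSum n ws + wordSum n ws′
  wordSum-++ n ws ws′ =
    trans (cong sum (List.map-++ _ ws ws′)) (sum-++ (map (λ w → weight n (partner w)) ws) _)

  wordSum-prepend : ∀ β m ws → wordSum (size β + m) (map (β ∷_) ws) ≡ blockWeight β * wordSum m ws
  wordSum-prepend β m ws = begin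
    sum (map (λ w → weight (size β + m) (partner w)) (map (β ∷_) ws))
      ≡⟨ cong sum (List.map-∘ ws) ⟨
    sum (map (λ w → weight (size β + m) (β ⊕ partner w)) ws)
      ≡⟨ cong sum (List.map-cong (weight-⊕ β m ∘ partner) ws) ⟩
    sum (map (λ w → blockWeight β * weight m (partner w)) ws)
      ≡⟨ cong sum (List.map-∘ ws) ⟩
    sum (map (blockWeight β *_) (map (λ w → weight m (partner w)) ws))
      ≡⟨ sum-map-*ˡ (blockWeight β) (map (λ w → weight m (partner w)) ws) ⟩
    blockWeight β * wordSum m ws
      ∎
    where open ≡-Reasoning

  wordSum-prepend-words : ∀ β n ws →
    wordSum (size β + n) (map (β ∷_) (words n) ++ ws) ≡ blockWeight β * h a b n + wordSum (size β + n) ws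
  wordSum-prepend-words β n ws = begin
    wordSum (size β + n) (map (β ∷_) (words n) ++ ws)
      ≡⟨ wordSum-++ (size β + n) (map (β ∷_) (words n)) ws ⟩
    wordSum (size β + n) (map (β ∷_) (words n)) + wordSum (size β + n) ws
      ≡⟨ cong (_+ wordSum (size β + n) ws) (wordSum-prepend β n (words n)) ⟩
    blockWeight β * wordSum n (words n) + wordSum (size β + n) ws
      ≡⟨ cong (λ k → blockWeight β * k + wordSum (size β + n) ws) (h≡wordSum n) ⟨
    blockWeight β * h a b n + wordSum (size β + n) ws
      ∎
    where open ≡-Reasoning

  H : ℕ → ℕ
  H k = hℤ a b (k ⊖ 3)

  wordSum-words⁴ : ∀ n → wordSum (3 + n) (words⁴ n) ≡ b ^ 2 * H (2 + n)
  wordSum-words⁴ zero    = sym (*-zeroʳ (b ^ 2))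
  wordSum-words⁴ (suc n) = trans (wordSum-prepend cross n (words n)) (cong (b ^ 2 *_) (sym (h≡wordSum n)))

  wordSum-words³ : ∀ n → wordSum (2 + n) (words³ n) ≡ a * b * H (2 + n) + b ^ 2 * H (1 + n)
  wordSum-words³ zero    = sym (cong₂ _+_ (*-zeroʳ (a * b)) (*-zeroʳ (b ^ 2)))
  wordSum-words³ (suc n) =
    trans (wordSum-prepend-words arch n (words⁴ n)) (cong (a * b * h a b n +_) (wordSum-words⁴ n))

  wordSum-words² : ∀ n → wordSum (1 + n) (words² n) ≡ b * H (2 + n) + a * b * H (1 + n) + b ^ 2 * H n
  wordSum-words² zero    = sym (cong₂ _+_ (cong₂ _+_ (*-zeroʳ b) (*-zeroʳ (a * b))) (*-zeroʳ (b ^ 2)))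
  wordSum-words² (suc n) = begin
    wordSum (2 + n) (map (slant ∷_) (words n) ++ words³ n)
      ≡⟨ wordSum-prepend-words slant n (words³ n) ⟩
    b * h a b n + wordSum (2 + n) (words³ n)
      ≡⟨ cong (b * h a b n +_) (wordSum-words³ n) ⟩
    b * h a b n + (a * b * H (2 + n) + b ^ 2 * H (1 + n))
      ≡⟨ +-assoc (b * h a b n) _ _ ⟨
    b * h a b n + a * b * H (2 + n) + b ^ 2 * H (1 + n)
      ∎
    where open ≡-Reasoning

  open FourTermRecurrence a b (a * b) (b ^ 2)

  H-isSolution : IsSolution H
  H-isSolution n = begin
    h a b (suc n)
      ≡⟨ h≡wordSum (suc n) ⟩
    wordSum (1 + n) (map (mono ∷_) (words n) ++ words² n)
      ≡⟨ wordSum-prepend-words mono n (words² n) ⟩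
    a * h a b n + wordSum (1 + n) (words² n)
      ≡⟨ cong (a * h a b n +_) (wordSum-words² n) ⟩
    a * h a b n + (b * H (2 + n) + a * b * H (1 + n) + b ^ 2 * H n)
      ≡⟨ reassociate (a * h a b n) _ _ _ ⟩
    a * h a b n + b * H (2 + n) + a * b * H (1 + n) + b ^ 2 * H n
      ∎
    where
    open ≡-Reasoning
    reassociate : ∀ w x y z → w + (x + y + z) ≡ w + x + y + z
    reassociate = solve-∀

  h-addition : ∀ m n → h a b (m + n) ≡ bilinear H m n
  h-addition = addition-formula H-isSolution refl refl refl refl

-- Rewriting m ⊖ 1 to (2 + m) ⊖ 3, and so on,
-- turns each hℤ a b (k ⊖ j) into Colored.H a b (3 ∸ j + k).
theorem5 : (a b : ℕ) → 0 < a → 0 < b → (m n : ℕ) →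
    h a b (m + n) ≡
      h a b m * h a b n
      + hℤ a b (m ⊖ 1) * (b * hℤ a b (n ⊖ 1) + a * b * hℤ a b (n ⊖ 2) + b ^ 2 * hℤ a b (n ⊖ 3))
      + hℤ a b (m ⊖ 2) * (a * b * hℤ a b (n ⊖ 1) + b ^ 2 * hℤ a b (n ⊖ 2))
      + b ^ 2 * hℤ a b (n ⊖ 1) * hℤ a b (m ⊖ 3)
theorem5 a b _ _ m n
  rewrite sym (+-cancelˡ-⊖ 2 m 1) | sym (+-cancelˡ-⊖ 1 m 2)
        | sym (+-cancelˡ-⊖ 2 n 1) | sym (+-cancelˡ-⊖ 1 n 2)
  = Colored.h-addition a b m n
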